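{- Let $d \geq 2$ be an integer and let $G$ be a connected graph on $n$ vertices with minimum degree $\delta(G) \geq d$ and $\frac{8}{3}d \leq n \leq 3d$. Then $G^4$ has average degree at least $\frac{7}{3}d$.
   Context: All graphs are finite, simple and connected. For a graph $G$ and a positive integer $k$, the $k$th power $G^k$ is the graph with vertex set $V(G)$ in which two distinct vertices are adjacent if and only if their distance in $G$ is at most $k$. -}

module Defs where

open import Data.Nat using (ℕ; zero; suc; _+_)
open import Data.Bool using (Bool; true; false; _∧_; _∨_; not; if_then_else_)
open import Data.Fin using (Fin; zero; suc; _≟_)
open import Data.Product using (∃)
open import Relation.Binary.PropositionalEquality using (_≡_)
open import Relation.Nullary.Decidable using (⌊_⌋)

record Graph (n : ℕ) : Set where
  field
    adj    : Fin n → Fin n → Bool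
    sym    : ∀ u v → adj u v ≡ adj v u
    irrefl : ∀ v → adj v v ≡ false
open Graph public

countTrue : ∀ {n} → (Fin n → Bool) → ℕ
countTrue {zero}  f = 0
countTrue {suc n} f = (if f zero then 1 else 0) + countTrue (λ i → f (suc i))

anyFin : ∀ {n} → (Fin n → Bool) → Bool
anyFin {zero}  f = false
anyFin {suc n} f = f zero ∨ anyFin (λ i → f (suc i))

-- within G k u v = true  iff  there is a walk of length at most k from u to v,
-- i.e. dist_G(u,v) ≤ k.
within : ∀ {n} → Graph n → ℕ → Fin n → Fin n → Bool
within G zero    u v = ⌊ u ≟ v ⌋
within G (suc k) u v = within G k u v ∨ anyFin (λ w → adj G u w ∧ within G k w v)

Connected : ∀ {n} → Graph n → Set
Connected {n} G = ∀ (u v : Fin n) → ∃ λ k → within G k u v ≡ true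

degree : ∀ {n} → Graph n → Fin n → ℕ
degree G v = countTrue (adj G v)

powerAdj : ∀ {n} → Graph n → ℕ → Fin n → Fin n → Bool
powerAdj G k u v = not ⌊ u ≟ v ⌋ ∧ within G k u v

powerDegree : ∀ {n} → Graph n → ℕ → Fin n → ℕ
powerDegree G k v = countTrue (powerAdj G k v)

sumFin : ∀ {m} → (Fin m → ℕ) → ℕ
sumFin {zero}  f = 0
sumFin {suc m} f = f zero + sumFin (λ i → f (suc i))

-- sum of degrees in G^k (= n · average degree of G^k)
powerDegreeSum : ∀ {n} → Graph n → ℕ → ℕ
powerDegreeSum G k = sumFin (powerDegree G k)

module Submission where

-- Write N[a] for the closed neighbourhood of a (size ≥ d+1) and K = 2(d+1).  Since
-- n ≤ 3d < 3(d+1), there are no three vertices pairwise at distance ≥ 3.  Let F(u) be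
-- the set of vertices at distance > 4 from u; then every vertex lies in {u}, in the
-- G⁴-neighbourhood of u, or in F(u), so summing over u gives  n² ≤ n + P + Σ_u |F(u)|
-- with P the degree sum of G⁴.  If F(u) is non-empty, some z has distance exactly 3
-- from u, and F(u), N[u], N[z] are pairwise disjoint; hence |F(u)| ≤ m := n − K.
-- If some pair v, w is at distance > 4, a cut edge p₂p₃ of the radius-2 ball around v
-- splits the vertices with non-empty F into the parts inside and outside that ball,
-- each disjoint from two disjoint closed neighbourhoods, so at most 2m vertices have
-- non-empty F.  Thus Σ_u |F(u)| ≤ 2m², and elementary arithmetic finishes the proof.

open import Defs hiding (sym)
open import Data.Nat using (ℕ; zero; suc; _+_; _*_; _∸_; _≤_; z≤n; s≤s; _≤?_)
open import Data.Nat.Properties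
  using (module ≤-Reasoning; ≤-refl; ≤-trans; ≤-reflexive; <⇒≤; ≰⇒>; n≤1+n; m≤m+n; n≤0⇒n≡0;
         +-assoc; +-identityʳ; +-commutativeSemigroup; +-mono-≤; +-monoˡ-≤; +-monoʳ-≤;
         +-cancelˡ-≤; +-cancelʳ-≤; m+1+n≰m; *-assoc; *-identityˡ; *-identityʳ; *-distribʳ-+;
         *-monoˡ-≤; *-monoʳ-≤; *-cancelˡ-<; m≤n⇒m∸n≡0; m+[n∸m]≡n; m+n≤o⇒m≤o∸n)
open import Data.Nat.Tactic.RingSolver using (solve-∀)
open import Algebra.Properties.CommutativeSemigroup +-commutativeSemigroup using (interchange)
open import Data.Bool using (Bool; true; false; T; _∧_; _∨_; not; if_then_else_)
open import Data.Bool.Properties using (T-∨; T-∧; T-≡)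
open import Data.Fin using (Fin; zero; suc; _≟_)
open import Data.Fin.Properties using (suc-injective)
open import Data.Product using (∃; _×_; _,_)
open import Data.Sum using (_⊎_; inj₁; inj₂)
open import Data.Unit using (tt)
open import Data.Empty using (⊥; ⊥-elim)
open import Function using (_∘_; Equivalence)
open import Relation.Binary.PropositionalEquality using (_≡_; refl; cong; cong₂; sym; trans; subst; subst₂)
open import Relation.Nullary using (¬_; yes; no)
open import Relation.Nullary.Decidable using (⌊_⌋; ⌊⌋-map′; toWitness; fromWitness; T?)

VSet : ℕ → Set
VSet n = Fin n → Bool

_∈_ : ∀ {n} → Fin n → VSet n → Set
z ∈ S = T (S z)

_⊆_ : ∀ {n} → VSet n → VSet n → Set
S ⊆ R = ∀ z → z ∈ S → z ∈ R

_∪_ : ∀ {n} → VSet n → VSet n → VSet n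
(S ∪ R) z = S z ∨ R z

Disjoint : ∀ {n} → VSet n → VSet n → Set
Disjoint S R = ∀ z → z ∈ S → z ∈ R → ⊥

∣_∣ : ∀ {n} → VSet n → ℕ
∣ S ∣ = countTrue S

[_] : Bool → ℕ
[ b ] = if b then 1 else 0

ind-mono : ∀ {a b} → (T a → T b) → [ a ] ≤ [ b ]
ind-mono {false} _ = z≤n
ind-mono {true} {true} _ = ≤-refl
ind-mono {true} {false} a⇒b = ⊥-elim (a⇒b tt)

ind-∨ : ∀ a b → [ a ∨ b ] ≤ [ a ] + [ b ]
ind-∨ true b = s≤s z≤n
ind-∨ false b = ≤-refl

ind-∨-disjoint : ∀ {a b} → (T a → T b → ⊥) → [ a ] + [ b ] ≡ [ a ∨ b ]
ind-∨-disjoint {true} {true} a#b = ⊥-elim (a#b tt tt)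
ind-∨-disjoint {true} {false} _ = refl
ind-∨-disjoint {false} _ = refl

count-cong : ∀ {n} {S R : VSet n} → (∀ z → S z ≡ R z) → ∣ S ∣ ≡ ∣ R ∣
count-cong {zero} _ = refl
count-cong {suc n} S≗R = cong₂ _+_ (cong [_] (S≗R zero)) (count-cong (S≗R ∘ suc))

count-mono : ∀ {n} {S R : VSet n} → S ⊆ R → ∣ S ∣ ≤ ∣ R ∣
count-mono {zero} _ = z≤n
count-mono {suc n} S⊆R = +-mono-≤ (ind-mono (S⊆R zero)) (count-mono (S⊆R ∘ suc))

count-∪ : ∀ {n} (S R : VSet n) → ∣ S ∪ R ∣ ≤ ∣ S ∣ + ∣ R ∣
count-∪ {zero} S R = z≤n
count-∪ {suc n} S R = ≤-trans (+-mono-≤ (ind-∨ (S zero) (R zero)) (count-∪ (S ∘ suc) (R ∘ suc)))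
                              (≤-reflexive (interchange [ S zero ] [ R zero ] _ _))

count-disjoint-∪ : ∀ {n} {S R : VSet n} → Disjoint S R → ∣ S ∣ + ∣ R ∣ ≡ ∣ S ∪ R ∣
count-disjoint-∪ {zero} _ = refl
count-disjoint-∪ {suc n} {S} {R} S#R = trans (interchange [ S zero ] _ [ R zero ] _)
  (cong₂ _+_ (ind-∨-disjoint (S#R zero)) (count-disjoint-∪ (S#R ∘ suc)))

count-all : ∀ {n} → ∣ (λ (_ : Fin n) → true) ∣ ≡ n
count-all {zero} = refl
count-all {suc n} = cong suc count-all

count-≤ : ∀ {n} (S : VSet n) → ∣ S ∣ ≤ n
count-≤ {n} S = ≤-trans (count-mono {S = S} (λ _ _ → tt)) (≤-reflexive (count-all {n}))

count-cover : ∀ {n} {S : VSet n} → (∀ z → z ∈ S) → n ≤ ∣ S ∣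
count-cover every = ≤-trans (≤-reflexive (sym count-all)) (count-mono (λ z _ → every z))

count-singleton : ∀ {n} (u : Fin n) → ∣ (λ z → ⌊ u ≟ z ⌋) ∣ ≡ 1
count-singleton {suc n} zero = cong suc (count-none {n})
  where
    count-none : ∀ {m} → ∣ (λ (_ : Fin m) → false) ∣ ≡ 0
    count-none {zero} = refl
    count-none {suc m} = count-none {m}
count-singleton {suc n} (suc u) =
  trans (count-cong (λ z → ⌊⌋-map′ (cong suc) suc-injective (u ≟ z))) (count-singleton u)

count-disjoint₃ : ∀ {n} {S R Q : VSet n} → Disjoint S R → Disjoint S Q → Disjoint R Q
  → ∣ S ∣ + ∣ R ∣ + ∣ Q ∣ ≤ n
count-disjoint₃ {S = S} {R} {Q} S#R S#Q R#Q = begin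
  ∣ S ∣ + ∣ R ∣ + ∣ Q ∣  ≡⟨ cong (_+ ∣ Q ∣) (count-disjoint-∪ S#R) ⟩
  ∣ S ∪ R ∣ + ∣ Q ∣      ≡⟨ count-disjoint-∪ SR#Q ⟩
  ∣ (S ∪ R) ∪ Q ∣        ≤⟨ count-≤ _ ⟩
  _                      ∎
  where
    open ≤-Reasoning
    SR#Q : Disjoint (S ∪ R) Q
    SR#Q z z∈S∪R z∈Q with Equivalence.to T-∨ z∈S∪R
    ... | inj₁ z∈S = S#Q z z∈S z∈Q
    ... | inj₂ z∈R = R#Q z z∈R z∈Q

count-cover₃ : ∀ {n} {S R Q : VSet n} → (∀ z → z ∈ ((S ∪ R) ∪ Q)) → n ≤ ∣ S ∣ + ∣ R ∣ + ∣ Q ∣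
count-cover₃ {S = S} {R} {Q} every = begin
  _                     ≤⟨ count-cover every ⟩
  ∣ (S ∪ R) ∪ Q ∣       ≤⟨ count-∪ (S ∪ R) Q ⟩
  ∣ S ∪ R ∣ + ∣ Q ∣     ≤⟨ +-monoˡ-≤ ∣ Q ∣ (count-∪ S R) ⟩
  ∣ S ∣ + ∣ R ∣ + ∣ Q ∣ ∎
  where open ≤-Reasoning

any-intro : ∀ {n} (S : VSet n) z → z ∈ S → T (anyFin S)
any-intro S zero z∈S = Equivalence.from T-∨ (inj₁ z∈S)
any-intro S (suc z) z∈S = Equivalence.from T-∨ (inj₂ (any-intro (S ∘ suc) z z∈S))

any-witness : ∀ {n} (S : VSet n) → T (anyFin S) → ∃ λ z → z ∈ S
any-witness {suc n} S any with Equivalence.to T-∨ any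
... | inj₁ zero∈S = zero , zero∈S
... | inj₂ any′ with any-witness (S ∘ suc) any′
... | z , z∈S = suc z , z∈S

any-none : ∀ {n} (S : VSet n) → ¬ T (anyFin S) → ∣ S ∣ ≡ 0
any-none {zero} S _ = refl
any-none {suc n} S none with S zero
... | true = ⊥-elim (none tt)
... | false = any-none (S ∘ suc) none

count-≤-if-nonempty : ∀ {n} (S : VSet n) {m} → (∀ z → z ∈ S → ∣ S ∣ ≤ m) → ∣ S ∣ ≤ [ anyFin S ] * m
count-≤-if-nonempty S {m} bound with anyFin S | any-witness S | any-none S
... | true  | witness | _    = let z , z∈S = witness tt in ≤-trans (bound z z∈S) (≤-reflexive (sym (*-identityˡ m)))
... | false | _       | none = ≤-reflexive (none λ ())

count-≤-if-element : ∀ {n} (S : VSet n) {m} → (∀ z → z ∈ S → ∣ S ∣ ≤ m) → ∣ S ∣ ≤ m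
count-≤-if-element S {m} bound = ≤-trans (count-≤-if-nonempty S bound) (indicator-scale (anyFin S))
  where
    indicator-scale : ∀ b → [ b ] * m ≤ m
    indicator-scale true = ≤-reflexive (*-identityˡ m)
    indicator-scale false = z≤n

sum-mono : ∀ {n} {f g : Fin n → ℕ} → (∀ i → f i ≤ g i) → sumFin f ≤ sumFin g
sum-mono {zero} _ = z≤n
sum-mono {suc n} f≤g = +-mono-≤ (f≤g zero) (sum-mono (f≤g ∘ suc))

sum-+ : ∀ {n} (f g : Fin n → ℕ) → sumFin (λ i → f i + g i) ≡ sumFin f + sumFin g
sum-+ {zero} f g = refl
sum-+ {suc n} f g = trans (cong (f zero + g zero +_) (sum-+ (f ∘ suc) (g ∘ suc)))
                          (interchange (f zero) (g zero) _ _)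

sum-const : ∀ {n} c → sumFin {n} (λ _ → c) ≡ n * c
sum-const {zero} c = refl
sum-const {suc n} c = cong (c +_) (sum-const {n} c)

sum-indicator : ∀ {n} (S : VSet n) m → sumFin (λ z → [ S z ] * m) ≡ ∣ S ∣ * m
sum-indicator {zero} S m = refl
sum-indicator {suc n} S m = trans (cong ([ S zero ] * m +_) (sum-indicator (S ∘ suc) m))
                                  (sym (*-distribʳ-+ m [ S zero ] _))

not-T : ∀ {b} → T (not b) → ¬ T b
not-T {false} _ ()
not-T {true} ()

-- Walks and distances.  Near k u v says that dist(u, v) ≤ k; it wraps the Boolean
-- `within` in a record so that its indices can be inferred.

module Distance {n : ℕ} (G : Graph n) where

  Edge : Fin n → Fin n → Set
  Edge u v = T (adj G u v)

  record Near (k : ℕ) (u v : Fin n) : Set where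
    constructor near
    field walk : T (within G k u v)
  open Near public

  edge-sym : ∀ {u v} → Edge u v → Edge v u
  edge-sym {u} {v} e = subst T (Graph.sym G u v) e

  near-zero : ∀ {u v} → Near 0 u v → u ≡ v
  near-zero (near p) = toWitness p

  near-suc : ∀ {k u v} → Near k u v → Near (suc k) u v
  near-suc (near p) = near (Equivalence.from T-∨ (inj₁ p))

  near-+ : ∀ j {k u v} → Near k u v → Near (j + k) u v
  near-+ zero p = p
  near-+ (suc j) p = near-suc (near-+ j p)

  near-cons : ∀ {k u w v} → Edge u w → Near k w v → Near (suc k) u v
  near-cons {k} {u} {w} {v} e (near p) =
    near (Equivalence.from T-∨ (inj₂ (any-intro (λ x → adj G u x ∧ within G k x v) w (Equivalence.from T-∧ (e , p)))))

  near-split : ∀ {k u v} → Near (suc k) u v → Near k u v ⊎ ∃ λ w → Edge u w × Near k w v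
  near-split {k} {u} {v} (near p) with Equivalence.to T-∨ p
  ... | inj₁ q = inj₁ (near q)
  ... | inj₂ q with any-witness (λ x → adj G u x ∧ within G k x v) q
  ... | w , r = let e , q′ = Equivalence.to T-∧ r in inj₂ (w , e , near q′)

  near-refl : ∀ k u → Near k u u
  near-refl zero u = near (fromWitness refl)
  near-refl (suc k) u = near-suc (near-refl k u)

  edge-near : ∀ {u v} → Edge u v → Near 1 u v
  edge-near e = near-cons e (near-refl 0 _)

  near-trans : ∀ a {b u w v} → Near a u w → Near b w v → Near (a + b) u v
  near-trans zero p q rewrite near-zero p = q
  near-trans (suc a) p q with near-split p
  ... | inj₁ p′ = near-suc (near-trans a p′ q)
  ... | inj₂ (x , e , p′) = near-cons e (near-trans a p′ q)

  near-snoc : ∀ k {u x y} → Near k u x → Edge x y → Near (suc k) u y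
  near-snoc zero p e rewrite near-zero p = edge-near e
  near-snoc (suc k) p e with near-split p
  ... | inj₁ p′ = near-suc (near-snoc k p′ e)
  ... | inj₂ (w , e′ , p′) = near-cons e′ (near-snoc k p′ e)

  near-sym : ∀ k {u v} → Near k u v → Near k v u
  near-sym zero p rewrite near-zero p = near-refl 0 _
  near-sym (suc k) p with near-split p
  ... | inj₁ p′ = near-suc (near-sym k p′)
  ... | inj₂ (w , e , p′) = near-snoc k (near-sym k p′) (edge-sym e)

  far-sym : ∀ k {u v} → ¬ Near k u v → ¬ Near k v u
  far-sym k far = far ∘ near-sym k

  far-+ : ∀ j {k u v} → ¬ Near (j + k) u v → ¬ Near k u v
  far-+ j far = far ∘ near-+ j

  far-from : ∀ a {b x y z} → Near a x y → ¬ Near (a + b) x z → ¬ Near b y z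
  far-from a xy far yz = far (near-trans a xy yz)

  -- In a connected graph, a vertex outside the radius-r ball around u forces an edge
  -- leaving that ball.  Proved by following a walk from u to y until it first exits.
  boundary-edge : Connected G → ∀ r {u y} → ¬ Near r u y
    → ∃ λ x → ∃ λ z → Near r u x × Edge x z × ¬ Near r u z
  boundary-edge connected r {u} {y} far =
    let k , path = connected u y in exit k (near-refl r u) (near (Equivalence.from T-≡ path))
    where
      exit : ∀ k {x} → Near r u x → Near k x y → ∃ λ x → ∃ λ z → Near r u x × Edge x z × ¬ Near r u z
      exit zero ux p rewrite near-zero p = ⊥-elim (far ux)
      exit (suc k) ux p with near-split p
      ... | inj₁ p′ = exit k ux p′
      ... | inj₂ (w , e , p′) with T? (within G r u w)
      ...   | yes uw = exit k (near uw) p′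
      ...   | no ¬uw = _ , w , ux , e , ¬uw ∘ walk

-- The arithmetic.  With P the degree sum of G⁴ and S the number of ordered pairs at
-- distance > 4, the graph argument yields n² ≤ n + P + S and S ≤ 2m², m = n ∸ 2(d+1).

-- The vertices left over by two disjoint closed neighbourhoods of size ≥ d+1.
spare : ℕ → ℕ → ℕ
spare d n = n ∸ (suc d + suc d)

cancel-slack : ∀ {L X a c} → X + a ≡ L + c → a ≤ c → L ≤ X
cancel-slack {L} {X} {a} {c} eq a≤c =
  +-cancelʳ-≤ a L X (≤-trans (+-monoʳ-≤ L a≤c) (≤-reflexive (sym eq)))

-- 8d ≤ 3n with d ≥ 2 leaves room for 7d + 3 ≤ 3n (for d = 2 because 3 ∤ 16).
three-n-bound : ∀ {d n} → 2 ≤ d → 8 * d ≤ 3 * n → 7 * d + 3 ≤ 3 * n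
three-n-bound {suc zero} (s≤s ())
three-n-bound {suc (suc zero)} {n} _ 16≤3n = ≤-trans (n≤1+n 17) (*-monoʳ-≤ 3 6≤n)
  where
    6≤n : 6 ≤ n
    6≤n = *-cancelˡ-< 3 5 n 16≤3n
three-n-bound {suc (suc (suc d))} _ 8d≤3n =
  ≤-trans (≤-trans (+-monoʳ-≤ (7 * (3 + d)) (s≤s (s≤s (s≤s z≤n)))) (≤-reflexive (eq d))) 8d≤3n
  where
    eq : ∀ d → 7 * (3 + d) + (3 + d) ≡ 8 * (3 + d)
    eq = solve-∀

-- No far pairs: 3P ≥ 3n² − 3n ≥ 7dn.
arith-no-far-pairs : ∀ {d n P} → 2 ≤ d → 8 * d ≤ 3 * n → n * n ≤ n + P → 7 * d * n ≤ 3 * P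
arith-no-far-pairs {d} {n} {P} 2≤d 8d≤3n square = +-cancelʳ-≤ (3 * n) (7 * d * n) (3 * P) (begin
  7 * d * n + 3 * n  ≡⟨ lhs d n ⟩
  (7 * d + 3) * n    ≤⟨ *-monoˡ-≤ n (three-n-bound {d} {n} 2≤d 8d≤3n) ⟩
  3 * n * n          ≡⟨ *-assoc 3 n n ⟩
  3 * (n * n)        ≤⟨ *-monoʳ-≤ 3 square ⟩
  3 * (n + P)        ≡⟨ rhs n P ⟩
  3 * P + 3 * n      ∎)
  where
    open ≤-Reasoning
    lhs : ∀ d n → 7 * d * n + 3 * n ≡ (7 * d + 3) * n
    lhs = solve-∀
    rhs : ∀ n P → 3 * (n + P) ≡ 3 * P + 3 * n
    rhs = solve-∀

-- Far pairs present, n = 2(d+1) + m and d = m + 2 + b: then 8d ≤ 3n means 2b ≤ m + 2,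
-- and 3n² − 7dn − 3n − 6m² = 15m + 6 + bm − 4b − 2b² ≥ 0.
arith-far-pairs : ∀ {d n m b P S} → d ≡ m + 2 + b → n ≡ suc d + suc d + m
  → 8 * d ≤ 3 * n → n * n ≤ n + P + S → S ≤ (m + m) * m → 7 * d * n ≤ 3 * P
arith-far-pairs {d} {n} {m} {b} {P} {S} refl refl 8d≤3n square far =
  +-cancelʳ-≤ (3 * n + 6 * (m * m)) (7 * d * n) (3 * P) (begin
    7 * d * n + (3 * n + 6 * (m * m))  ≤⟨ cancel-slack (expand m b) slack ⟩
    3 * (n * n)                        ≤⟨ *-monoʳ-≤ 3 (≤-trans square (+-monoʳ-≤ (n + P) far)) ⟩
    3 * (n + P + (m + m) * m)          ≡⟨ regroup n P m ⟩
    3 * P + (3 * n + 6 * (m * m))      ∎)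
  where
    open ≤-Reasoning
    2b≤m+2 : 2 * b ≤ m + 2
    2b≤m+2 = +-cancelˡ-≤ (8 * m + 16 + 6 * b) (2 * b) (m + 2) (subst₂ _≤_ (eight m b) (three m b) 8d≤3n)
      where
        eight : ∀ m b → 8 * (m + 2 + b) ≡ 8 * m + 16 + 6 * b + 2 * b
        eight = solve-∀
        three : ∀ m b → 3 * (suc (m + 2 + b) + suc (m + 2 + b) + m) ≡ 8 * m + 16 + 6 * b + (m + 2)
        three = solve-∀
    slack : 2 * b * b + 6 * b ≤ (m + 2) * b + 15 * m + 6
    slack = begin
      2 * b * b + 6 * b              ≡⟨ cong (2 * b * b +_) (*-assoc 3 2 b) ⟩
      2 * b * b + 3 * (2 * b)        ≤⟨ +-mono-≤ (*-monoˡ-≤ b 2b≤m+2) (*-monoʳ-≤ 3 2b≤m+2) ⟩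
      (m + 2) * b + 3 * (m + 2)      ≡⟨ cong ((m + 2) * b +_) (triple m) ⟩
      (m + 2) * b + (3 * m + 6)      ≤⟨ +-monoʳ-≤ ((m + 2) * b) (+-monoˡ-≤ 6 (*-monoˡ-≤ m (m≤m+n 3 12))) ⟩
      (m + 2) * b + (15 * m + 6)     ≡⟨ +-assoc ((m + 2) * b) (15 * m) 6 ⟨
      (m + 2) * b + 15 * m + 6       ∎
      where
        triple : ∀ m → 3 * (m + 2) ≡ 3 * m + 6
        triple = solve-∀
    expand : ∀ m b → let d = m + 2 + b ; n = suc d + suc d + m in
      3 * (n * n) + (2 * b * b + 6 * b) ≡ 7 * d * n + (3 * n + 6 * (m * m)) + ((m + 2) * b + 15 * m + 6)
    expand = solve-∀
    regroup : ∀ n P m → 3 * (n + P + (m + m) * m) ≡ 3 * P + (3 * n + 6 * (m * m))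
    regroup = solve-∀

-- The two cases combined: when n < 2(d+1) the spare count is 0 and so is S.
power-degree-arithmetic : ∀ {d n P S} → 2 ≤ d → 8 * d ≤ 3 * n → n ≤ 3 * d
  → n * n ≤ n + P + S → S ≤ (spare d n + spare d n) * spare d n → 7 * d * n ≤ 3 * P
power-degree-arithmetic {d} {n} {P} {S} 2≤d 8d≤3n n≤3d square far with suc d + suc d ≤? n
... | no K≰n = arith-no-far-pairs 2≤d 8d≤3n (≤-trans square (≤-reflexive (trans (cong (n + P +_) S≡0) (+-identityʳ (n + P)))))
  where
    S≡0 : S ≡ 0
    S≡0 = n≤0⇒n≡0 (subst (λ m → S ≤ (m + m) * m) (m≤n⇒m∸n≡0 (<⇒≤ (≰⇒> K≰n))) far)
... | yes K≤n = arith-far-pairs (sym (m+[n∸m]≡n m+2≤d)) (sym (m+[n∸m]≡n K≤n)) 8d≤3n square far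
  where
    m+2≤d : spare d n + 2 ≤ d
    m+2≤d = +-cancelˡ-≤ (d + d) (spare d n + 2) d (subst₂ _≤_ (regroup d (spare d n)) (triple d)
              (≤-trans (≤-reflexive (m+[n∸m]≡n K≤n)) n≤3d))
      where
        regroup : ∀ d m → suc d + suc d + m ≡ d + d + (m + 2)
        regroup = solve-∀
        triple : ∀ d → 3 * d ≡ d + d + d
        triple = solve-∀

module PowerFour {n : ℕ} (G : Graph n) (connected : Connected G) (d : ℕ)
                 (min-degree : ∀ v → d ≤ degree G v) (n≤3d : n ≤ 3 * d) where
  open Distance G

  N[_] : Fin n → VSet n
  N[ a ] = within G 1 a

  -- N[a] is the disjoint union of {a} and the neighbourhood of a (G has no loops).
  closed-nbhd-size : ∀ a → suc d ≤ ∣ N[ a ] ∣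
  closed-nbhd-size a = begin
    suc d                             ≤⟨ s≤s (min-degree a) ⟩
    1 + degree G a                    ≡⟨ cong (_+ degree G a) (count-singleton a) ⟨
    ∣ within G 0 a ∣ + ∣ adj G a ∣    ≡⟨ count-disjoint-∪ loopless ⟩
    ∣ within G 0 a ∪ adj G a ∣        ≤⟨ count-mono covered ⟩
    ∣ N[ a ] ∣                        ∎
    where
      open ≤-Reasoning
      loopless : Disjoint (within G 0 a) (adj G a)
      loopless z a≡z e with near-zero (near a≡z)
      ... | refl = subst T (irrefl G a) e
      covered : (within G 0 a ∪ adj G a) ⊆ N[ a ]
      covered z z∈ with Equivalence.to T-∨ z∈
      ... | inj₁ a≡z = walk (near-suc {0} (near a≡z))
      ... | inj₂ e   = walk (edge-near e)

  nbhds-disjoint : ∀ {a b} → ¬ Near 2 a b → Disjoint N[ a ] N[ b ]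
  nbhds-disjoint far z az bz = far (near-trans 1 (near az) (near-sym 1 (near bz)))

  -- The size of two disjoint closed neighbourhoods.
  K : ℕ
  K = suc d + suc d

  squeeze : ∀ {a b} (S : VSet n) → ¬ Near 2 a b → Disjoint S N[ a ] → Disjoint S N[ b ] → ∣ S ∣ + K ≤ n
  squeeze {a} {b} S far S#a S#b = begin
    ∣ S ∣ + (suc d + suc d)         ≡⟨ +-assoc ∣ S ∣ (suc d) (suc d) ⟨
    ∣ S ∣ + suc d + suc d           ≤⟨ +-mono-≤ (+-monoʳ-≤ ∣ S ∣ (closed-nbhd-size a)) (closed-nbhd-size b) ⟩
    ∣ S ∣ + ∣ N[ a ] ∣ + ∣ N[ b ] ∣ ≤⟨ count-disjoint₃ S#a S#b (nbhds-disjoint far) ⟩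
    n                               ∎
    where open ≤-Reasoning

  -- Since n < 3(d+1), no three vertices are pairwise at distance > 2.
  no-three-far : ∀ {a b c} → ¬ Near 2 a b → ¬ Near 2 a c → Near 2 b c
  no-three-far {a} {b} {c} ab ac with T? (within G 2 b c)
  ... | yes bc = near bc
  ... | no ¬bc = ⊥-elim (m+1+n≰m (3 * d) (begin
    3 * d + 3       ≡⟨ regroup d ⟩
    suc d + K       ≤⟨ +-monoˡ-≤ K (closed-nbhd-size c) ⟩
    ∣ N[ c ] ∣ + K  ≤⟨ squeeze N[ c ] ab (nbhds-disjoint (far-sym 2 ac)) (nbhds-disjoint (far-sym 2 (¬bc ∘ walk))) ⟩
    n               ≤⟨ n≤3d ⟩
    3 * d           ∎))
    where
      open ≤-Reasoning
      regroup : ∀ d → 3 * d + 3 ≡ suc d + (suc d + suc d)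
      regroup = solve-∀

  -- A neighbour q′ of a vertex q far from c is within distance 4 of every vertex t
  -- far from c; so a vertex s with t beyond distance 4 is not adjacent to q′.
  far-beyond : ∀ {c q q′ s t} → ¬ Near 2 c q → Edge q′ q → ¬ Near 2 c t → ¬ Near 4 s t → ¬ Near 1 q′ s
  far-beyond cq e ct st q′s =
    st (near-trans 2 (near-trans 1 (near-sym 1 q′s) (edge-near e)) (no-three-far cq ct))

  -- The vertices at distance > 4 from u, i.e. the non-neighbours of u in G⁴ other than u.
  farSet : Fin n → VSet n
  farSet u y = not (within G 4 u y)

  farSet-far : ∀ {u y} → y ∈ farSet u → ¬ Near 4 u y
  farSet-far y∈ = not-T y∈ ∘ walk

  hasFar : VSet n
  hasFar u = anyFin (farSet u)

  far-witness : ∀ {u} → u ∈ hasFar → ∃ λ y → ¬ Near 4 u y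
  far-witness {u} u∈ = let y , y∈ = any-witness (farSet u) u∈ in y , farSet-far y∈

  -- If u has a vertex at distance > 4, some z is at distance exactly 3 from u, and
  -- farSet u avoids both N[u] and N[z].
  farSet-bound : ∀ {u y} → ¬ Near 4 u y → ∣ farSet u ∣ + K ≤ n
  farSet-bound {u} uy with boundary-edge connected 2 (far-+ 2 uy)
  ... | x , z , ux , e , uz = squeeze (farSet u) uz far#u far#z
    where
      far#u : Disjoint (farSet u) N[ u ]
      far#u s s∈ us = farSet-far s∈ (near-+ 3 (near us))
      far#z : Disjoint (farSet u) N[ z ]
      far#z s s∈ zs = farSet-far s∈ (near-trans 3 (near-snoc 2 ux e) (near zs))

  farSet-size : ∀ u → ∣ farSet u ∣ ≤ [ hasFar u ] * spare d n
  farSet-size u = count-≤-if-nonempty (farSet u) λ y y∈ → m+n≤o⇒m≤o∸n _ (farSet-bound (farSet-far y∈))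

  -- Given v, w at distance > 4, take an edge p₂p₃ leaving the radius-2 ball around v.
  -- The vertices of hasFar inside that ball avoid N[w] and N[p₂]; those outside avoid
  -- N[v] and N[p₃].
  far-pair-bound : ∀ {v w} → ¬ Near 4 v w → ∣ hasFar ∣ ≤ spare d n + spare d n
  far-pair-bound {v} {w} vw with boundary-edge connected 2 (far-+ 2 vw)
  ... | p₂ , p₃ , vp₂ , e , vp₃ = begin
    ∣ hasFar ∣                ≤⟨ count-mono split ⟩
    ∣ inner ∪ outer ∣         ≤⟨ count-∪ inner outer ⟩
    ∣ inner ∣ + ∣ outer ∣     ≤⟨ +-mono-≤ (spare-of inner-bound) (spare-of outer-bound) ⟩
    spare d n + spare d n     ∎
    where
      open ≤-Reasoning
      inner outer : VSet n
      inner x = hasFar x ∧ within G 2 v x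
      outer x = hasFar x ∧ not (within G 2 v x)

      split : hasFar ⊆ (inner ∪ outer)
      split x x∈ = case-split (hasFar x) (within G 2 v x) x∈
        where
          case-split : ∀ a b → T a → T ((a ∧ b) ∨ (a ∧ not b))
          case-split true true _ = tt
          case-split true false _ = tt

      spare-of : ∀ {S : VSet n} → ∣ S ∣ + K ≤ n → ∣ S ∣ ≤ spare d n
      spare-of = m+n≤o⇒m≤o∸n _

      wp₂ : ¬ Near 2 w p₂
      wp₂ = far-sym 2 (far-from 2 vp₂ vw)

      inner-bound : ∣ inner ∣ + K ≤ n
      inner-bound = squeeze inner wp₂ inner#w inner#p₂
        where
          inner#w : Disjoint inner N[ w ]
          inner#w x x∈ wx = let _ , vx = Equivalence.to T-∧ x∈ in
            vw (near-+ 1 (near-trans 2 (near vx) (near-sym 1 (near wx))))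
          inner#p₂ : Disjoint inner N[ p₂ ]
          inner#p₂ x x∈ p₂x = let far , vx = Equivalence.to T-∧ x∈ ; y , xy = far-witness far in
            far-beyond vp₃ e (far-from 2 (near-sym 2 (near vx)) xy) xy (near p₂x)

      outer-bound : ∣ outer ∣ + K ≤ n
      outer-bound = squeeze outer vp₃ outer#v outer#p₃
        where
          outer#v : Disjoint outer N[ v ]
          outer#v y y∈ vy = let _ , ¬vy = Equivalence.to T-∧ y∈ in
            not-T {within G 2 v y} ¬vy (walk (near-suc {1} (near vy)))
          outer#p₃ : Disjoint outer N[ p₃ ]
          outer#p₃ y y∈ p₃y = let far , ¬vy = Equivalence.to T-∧ y∈ ; z , yz = far-witness far
                                  wy = no-three-far (far-+ 2 vw) (not-T ¬vy ∘ walk) in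
            far-beyond wp₂ (edge-sym e) (far-from 2 (near-sym 2 wy) yz) yz (near p₃y)

  hasFar-size : ∣ hasFar ∣ ≤ spare d n + spare d n
  hasFar-size = count-≤-if-element hasFar λ v v∈ → let w , vw = far-witness v∈ in far-pair-bound vw

  far-pairs-bound : sumFin (λ u → ∣ farSet u ∣) ≤ (spare d n + spare d n) * spare d n
  far-pairs-bound = begin
    sumFin (λ u → ∣ farSet u ∣)               ≤⟨ sum-mono farSet-size ⟩
    sumFin (λ u → [ hasFar u ] * spare d n)   ≡⟨ sum-indicator hasFar (spare d n) ⟩
    ∣ hasFar ∣ * spare d n                    ≤⟨ *-monoˡ-≤ (spare d n) hasFar-size ⟩
    (spare d n + spare d n) * spare d n       ∎
    where open ≤-Reasoning

  vertex-cover : ∀ u → n ≤ 1 + powerDegree G 4 u + ∣ farSet u ∣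
  vertex-cover u = begin
    n                                                    ≤⟨ count-cover₃ (λ z → trichotomy ⌊ u ≟ z ⌋ (within G 4 u z)) ⟩
    ∣ within G 0 u ∣ + powerDegree G 4 u + ∣ farSet u ∣  ≡⟨ cong (λ k → k + powerDegree G 4 u + ∣ farSet u ∣) (count-singleton u) ⟩
    1 + powerDegree G 4 u + ∣ farSet u ∣                 ∎
    where
      open ≤-Reasoning
      trichotomy : ∀ a b → T ((a ∨ (not a ∧ b)) ∨ not b)
      trichotomy true _ = tt
      trichotomy false true = tt
      trichotomy false false = tt

  power-degree-square : n * n ≤ n + powerDegreeSum G 4 + sumFin (λ u → ∣ farSet u ∣)
  power-degree-square = begin
    n * n                                           ≡⟨ sum-const {n} n ⟨
    sumFin {n} (λ _ → n)                            ≤⟨ sum-mono vertex-cover ⟩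
    sumFin (λ u → 1 + powerDegree G 4 u + F u)      ≡⟨ sum-+ (λ u → 1 + powerDegree G 4 u) F ⟩
    sumFin (λ u → 1 + powerDegree G 4 u) + S        ≡⟨ cong (_+ S) (sum-+ (λ _ → 1) (powerDegree G 4)) ⟩
    sumFin {n} (λ _ → 1) + powerDegreeSum G 4 + S   ≡⟨ cong (λ k → k + powerDegreeSum G 4 + S) (trans (sum-const {n} 1) (*-identityʳ n)) ⟩
    n + powerDegreeSum G 4 + S                      ∎
    where
      open ≤-Reasoning
      F : Fin n → ℕ
      F u = ∣ farSet u ∣
      S : ℕ
      S = sumFin F

lemma3p1 : (d n : ℕ) → 2 ≤ d → (G : Graph n) → Connected G
    → (∀ (v : Fin n) → d ≤ degree G v)
    → 8 * d ≤ 3 * n → n ≤ 3 * d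
    → 7 * d * n ≤ 3 * powerDegreeSum G 4
lemma3p1 d n 2≤d G connected min-degree 8d≤3n n≤3d =
  power-degree-arithmetic 2≤d 8d≤3n n≤3d power-degree-square far-pairs-bound
  where open PowerFour G connected d min-degree n≤3d
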